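{- Let $G_{k,l}=P_k\,\square\,P_l$ be the $k\times l$ grid graph. If $k$ or $l$ is even, then $G_{k,l}$ has a canonical ESD labeling.
   Context: $P_k\,\square\,P_l$ denotes the Cartesian product of the paths on $k$ and $l$ vertices. For a graph $G=(V,E)$ and $m\in\mathbb N$, a vertex labeling $\phi:V\to\{1,\dots,m\}$ is an edge-sum distinguishing (ESD) labeling if $\phi$ is injective and the edge-weights $w_\phi(uv)=\phi(u)+\phi(v)$ are pairwise distinct over all edges $uv\in E$. It is a canonical ESD labeling if $m=|V|$. -}

module Defs where

open import Data.Nat using (ℕ; suc; _+_; _≤_; _*_)
open import Data.Fin using (Fin; toℕ)
open import Data.Product using (_×_; _,_; Σ)
open import Data.Sum using (_⊎_)
open import Relation.Binary.PropositionalEquality using (_≡_)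
open import Function.Definitions using (Injective)

record Graph : Set₁ where
  field
    V     : Set
    Adj   : V → V → Set

open Graph public

PathAdj : {k : ℕ} → Fin k → Fin k → Set
PathAdj i j = (suc (toℕ i) ≡ toℕ j) ⊎ (suc (toℕ j) ≡ toℕ i)

Grid : ℕ → ℕ → Graph
Grid k l = record
  { V   = Fin k × Fin l
  ; Adj = λ { (a , b) (c , d) → (PathAdj a c × b ≡ d) ⊎ (a ≡ c × PathAdj b d) } }

SameEdge : {V : Set} → V → V → V → V → Set
SameEdge u v x y = (u ≡ x × v ≡ y) ⊎ (u ≡ y × v ≡ x)

record IsESDLabeling (G : Graph) (m : ℕ) (φ : V G → ℕ) : Set where
  field
    range     : ∀ v → 1 ≤ φ v × φ v ≤ m
    injective : Injective _≡_ _≡_ φ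
    distinct  : ∀ u v x y → Adj G u v → Adj G x y →
                φ u + φ v ≡ φ x + φ y → SameEdge u v x y

-- Canonical ESD labeling of the grid: m = |V| = k * l.
HasCanonicalESDGrid : ℕ → ℕ → Set
HasCanonicalESDGrid k l =
  Σ (V (Grid k l) → ℕ) λ φ → IsESDLabeling (Grid k l) (k * l) φ

module Submission where

-- Let k = 2h and label the vertex (a , b) of P_k □ P_l (row a,
-- column b) by its row-major position  p(a , b) = k·b + a , plus one.
-- These labels are exactly 1, …, k·l.  A vertical edge (a , b)(a+1 , b)
-- gets weight (p+1) + (p+2) = 2(p+1) + 1, which is odd, while a
-- horizontal edge (a , b)(a , b+1) gets weight (p+1) + (p+k+1)
-- = 2(p+h+1), which is even.  So the parity of a weight tells the kind
-- of the edge, and within each kind the weight determines p, hence the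
-- lower/left endpoint (positions are injective), hence the edge.

open import Defs
open import Data.Nat using (ℕ)
open import Data.Nat.Divisibility using (_∣_)
open import Data.Sum using (_⊎_)

open import Data.Nat using (suc; _+_; _*_; _≤_; z≤n; s≤s)
open import Data.Nat.Properties
  using (suc-injective; +-suc; +-assoc; +-comm; *-comm; *-suc; +-cancelʳ-≡;
         *-cancelˡ-≡; even≢odd; ≤-trans; ≤-reflexive)
open import Data.Nat.Divisibility using (divides)
open import Data.Nat.Tactic.RingSolver using (solve-∀)
open import Data.Fin using (Fin; toℕ; combine)
open import Data.Fin.Properties using (toℕ<n; toℕ-injective; toℕ-combine; combine-injective)
open import Data.Product using (_×_; _,_; swap)
open import Data.Sum using (inj₁; inj₂)
open import Function.Definitions using (Injective)
open import Relation.Nullary using (contradiction)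
open import Relation.Binary.PropositionalEquality
  using (_≡_; refl; sym; trans; cong; subst; module ≡-Reasoning)

data Step {k l : ℕ} : Fin k × Fin l → Fin k × Fin l → Set where
  down  : ∀ {a c b} → suc (toℕ a) ≡ toℕ c → Step (a , b) (c , b)
  right : ∀ {a b d} → suc (toℕ b) ≡ toℕ d → Step (a , b) (a , d)

adj⇒step : ∀ {k l} (u v : Fin k × Fin l) → Adj (Grid k l) u v → Step u v ⊎ Step v u
adj⇒step _ _ (inj₁ (inj₁ p , refl)) = inj₁ (down p)
adj⇒step _ _ (inj₁ (inj₂ p , refl)) = inj₂ (down p)
adj⇒step _ _ (inj₂ (refl , inj₁ p)) = inj₁ (right p)
adj⇒step _ _ (inj₂ (refl , inj₂ p)) = inj₂ (right p)

StepsDetermined : ∀ {k l} → (Fin k × Fin l → ℕ) → Set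
StepsDetermined φ = ∀ {u v x y} → Step u v → Step x y →
                    φ u + φ v ≡ φ x + φ y → u ≡ x × v ≡ y

steps⇒distinct : ∀ {k l} (φ : Fin k × Fin l → ℕ) → StepsDetermined φ →
                 ∀ u v x y → Adj (Grid k l) u v → Adj (Grid k l) x y →
                 φ u + φ v ≡ φ x + φ y → SameEdge u v x y
steps⇒distinct φ det u v x y uv xy w with adj⇒step u v uv | adj⇒step x y xy
... | inj₁ s | inj₁ t = inj₁ (det s t w)
... | inj₁ s | inj₂ t = inj₂ (det s t (trans w (+-comm (φ x) (φ y))))
... | inj₂ s | inj₁ t = inj₂ (swap (det s t (trans (+-comm (φ v) (φ u)) w)))
... | inj₂ s | inj₂ t =
  inj₁ (swap (det s t (trans (+-comm (φ v) (φ u)) (trans w (+-comm (φ x) (φ y))))))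

swap-injective : ∀ {A B : Set} {u v : A × B} → swap u ≡ swap v → u ≡ v
swap-injective {u = _ , _} {v = _ , _} refl = refl

adj-transpose : ∀ {k l} (u v : Fin k × Fin l) →
                Adj (Grid k l) u v → Adj (Grid l k) (swap u) (swap v)
adj-transpose _ _ (inj₁ (p , q)) = inj₂ (q , p)
adj-transpose _ _ (inj₂ (p , q)) = inj₁ (q , p)

transpose : ∀ k l → HasCanonicalESDGrid l k → HasCanonicalESDGrid k l
transpose k l (ψ , L) = (λ v → ψ (swap v)) , record
  { range     = range′
  ; injective = λ eq → swap-injective (injective eq)
  ; distinct  = distinct′
  }
  where
  open IsESDLabeling L
  range′ : ∀ v → 1 ≤ ψ (swap v) × ψ (swap v) ≤ k * l
  range′ v with range (swap v)
  ... | lo , hi = lo , ≤-trans hi (≤-reflexive (*-comm l k))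
  distinct′ : ∀ u v x y → Adj (Grid k l) u v → Adj (Grid k l) x y →
              ψ (swap u) + ψ (swap v) ≡ ψ (swap x) + ψ (swap y) → SameEdge u v x y
  distinct′ u v x y uv xy w
    with distinct (swap u) (swap v) (swap x) (swap y) (adj-transpose u v uv) (adj-transpose x y xy) w
  ... | inj₁ (p , q) = inj₁ (swap-injective p , swap-injective q)
  ... | inj₂ (p , q) = inj₂ (swap-injective p , swap-injective q)

module RowMajor (h l : ℕ) where

  k : ℕ
  k = 2 * h

  index : Fin k × Fin l → Fin (l * k)
  index (a , b) = combine b a

  position : Fin k × Fin l → ℕ
  position v = toℕ (index v)

  label : Fin k × Fin l → ℕ
  label v = suc (position v)

  position-injective : Injective _≡_ _≡_ position
  position-injective {a , b} {a′ , b′} eq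
    with refl , refl ← combine-injective b a b′ a′ (toℕ-injective eq) = refl

  position-down : ∀ {a c b} → suc (toℕ a) ≡ toℕ c → position (c , b) ≡ suc (position (a , b))
  position-down {a} {c} {b} p = begin
    toℕ (combine b c)       ≡⟨ toℕ-combine b c ⟩
    k * toℕ b + toℕ c       ≡⟨ cong (k * toℕ b +_) (sym p) ⟩
    k * toℕ b + suc (toℕ a) ≡⟨ +-suc (k * toℕ b) (toℕ a) ⟩
    suc (k * toℕ b + toℕ a) ≡⟨ cong suc (toℕ-combine b a) ⟨
    suc (toℕ (combine b a)) ∎
    where open ≡-Reasoning

  position-right : ∀ {a b d} → suc (toℕ b) ≡ toℕ d → position (a , d) ≡ k + position (a , b)
  position-right {a} {b} {d} p = begin
    toℕ (combine d a)           ≡⟨ toℕ-combine d a ⟩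
    k * toℕ d + toℕ a           ≡⟨ cong (λ j → k * j + toℕ a) (sym p) ⟩
    k * suc (toℕ b) + toℕ a     ≡⟨ cong (_+ toℕ a) (*-suc k (toℕ b)) ⟩
    k + k * toℕ b + toℕ a       ≡⟨ +-assoc k (k * toℕ b) (toℕ a) ⟩
    k + (k * toℕ b + toℕ a)     ≡⟨ cong (k +_) (toℕ-combine b a) ⟨
    k + toℕ (combine b a)       ∎
    where open ≡-Reasoning

  down-weight : ∀ {a c b} → suc (toℕ a) ≡ toℕ c →
                label (a , b) + label (c , b) ≡ suc (2 * suc (position (a , b)))
  down-weight {a} {c} {b} p rewrite position-down {b = b} p = odd (position (a , b))
    where
    odd : ∀ n → suc n + suc (suc n) ≡ suc (2 * suc n)
    odd = solve-∀

  right-weight : ∀ {a b d} → suc (toℕ b) ≡ toℕ d →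
                 label (a , b) + label (a , d) ≡ 2 * suc (position (a , b) + h)
  right-weight {a} {b} {d} p rewrite position-right {a} p = even (position (a , b)) h
    where
    even : ∀ n h → suc n + suc (2 * h + n) ≡ 2 * suc (n + h)
    even = solve-∀

  halve : ∀ {m n} → 2 * m ≡ 2 * n → m ≡ n
  halve {m} {n} = *-cancelˡ-≡ m n 2

  steps-determined : StepsDetermined label
  steps-determined (down {b = b} p) (down p′) w
    with refl ← position-injective (suc-injective (halve (suc-injective
           (trans (sym (down-weight p)) (trans w (down-weight p′))))))
    = refl , cong (_, b) (toℕ-injective (trans (sym p) p′))
  steps-determined (down {a} {_} {b} p) (right {a′} {b′} p′) w =
    contradiction (sym (trans (sym (down-weight p)) (trans w (right-weight p′))))
                  (even≢odd (suc (position (a′ , b′) + h)) (suc (position (a , b))))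
  steps-determined (right {a} {b} p) (down {a′} {_} {b′} p′) w =
    contradiction (trans (sym (right-weight p)) (trans w (down-weight p′)))
                  (even≢odd (suc (position (a , b) + h)) (suc (position (a′ , b′))))
  steps-determined (right {a} p) (right p′) w
    with refl ← position-injective (+-cancelʳ-≡ h _ _ (suc-injective (halve
           (trans (sym (right-weight p)) (trans w (right-weight p′))))))
    = refl , cong (a ,_) (toℕ-injective (trans (sym p) p′))

  label-range : ∀ v → 1 ≤ label v × label v ≤ k * l
  label-range v = s≤s z≤n , ≤-trans (toℕ<n (index v)) (≤-reflexive (*-comm l k))

  canonical : HasCanonicalESDGrid k l
  canonical = label , record
    { range     = label-range
    ; injective = λ eq → position-injective (suc-injective eq)
    ; distinct  = steps⇒distinct label steps-determined
    }

even-grid : ∀ {k} l → 2 ∣ k → HasCanonicalESDGrid k l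
even-grid l (divides h refl) = subst (λ k → HasCanonicalESDGrid k l) (*-comm 2 h) (RowMajor.canonical h l)

theorem9 : (k l : ℕ) → (2 ∣ k) ⊎ (2 ∣ l) → HasCanonicalESDGrid k l
theorem9 k l (inj₁ 2∣k) = even-grid l 2∣k
theorem9 k l (inj₂ 2∣l) = transpose k l (even-grid k 2∣l)
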